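{- Let $n\ge 4$ and let $G$ be the game board consisting of a cycle $C_3$ and a cycle $C_n$ connected by a single common vertex $a$, such that every edge of $G$ belongs to exactly one of the two cycles (drawn in the plane so that the two cycles bound two distinct cells). Then Player~1 has a winning strategy in the Game of Cycles on $G$.
   Context: The Game of Cycles: the board is a simple planar graph with a fixed planar embedding; its cells are the bounded faces of the embedding. Two players alternate turns; on a turn a player chooses a currently unmarked edge and marks it with an arrow (an orientation), subject to the sink-source rule: no move may create a sink (a vertex all of whose incident edges are marked and point toward it) or a source (a vertex all of whose incident edges are marked and point away from it). A cycle cell is a cell all of whose boundary edges are marked and oriented consistently, all clockwise or all counterclockwise around the cell. The first player to create a cycle cell wins; if no cycle cell is created, the player who makes the last possible legal move wins (a player with no legal move loses). A winning strategy for a player is a strategy guaranteeing that player a win regardless of the opponent's moves. -}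

module Defs where

open import Data.Nat using (ℕ; zero; suc; _∸_; _<?_)
open import Data.Fin using (Fin; toℕ; fromℕ<) renaming (zero to f0; suc to fs)
open import Data.Fin.Properties using () renaming (_≟_ to _≟F_)
open import Data.Bool using (Bool; true; false; not; if_then_else_)
open import Data.Maybe using (Maybe; just; nothing)
open import Data.Product using (Σ; _×_; _,_; proj₁; proj₂)
open import Data.Sum using (_⊎_; inj₁; inj₂)
open import Data.Sum.Properties using (≡-dec)
open import Data.List using (List; []; _∷_; map; allFin)
open import Data.List.Relation.Unary.All using (All)
open import Data.List.Relation.Unary.Any using (Any)
open import Relation.Binary.PropositionalEquality using (_≡_)
open import Relation.Binary.Definitions using (DecidableEquality)
open import Relation.Nullary using (¬_; yes; no)

-- A game board: a (simple, plane) graph given by its vertex and edge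
-- sets, the endpoints of each edge (in a fixed reference orientation
-- tail → head), and its cells (bounded faces of the embedding).  A cell
-- is recorded as the cyclic list of its boundary edges, each tagged with
-- a Bool saying whether the reference orientation of the edge agrees
-- with a fixed traversal direction (say clockwise) around the cell.

record Board : Set₁ where
  field
    V     : Set
    E     : Set
    _≟E_  : DecidableEquality E
    ends  : E → V × V
    cells : List (List (E × Bool))

module Game (B : Board) where
  open Board B

  -- A marking of an edge with an arrow: true = tail → head (reference
  -- orientation), false = head → tail.
  Position : Set
  Position = E → Maybe Bool

  empty : Position
  empty _ = nothing

  play : Position → E → Bool → Position
  play p e o e' with e' ≟E e
  ... | yes _ = just o
  ... | no  _ = p e'

  headOf : E → Bool → V
  headOf e true  = proj₂ (ends e)
  headOf e false = proj₁ (ends e)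

  tailOf : E → Bool → V
  tailOf e true  = proj₁ (ends e)
  tailOf e false = proj₂ (ends e)

  Incident : E → V → Set
  Incident e v = (proj₁ (ends e) ≡ v) ⊎ (proj₂ (ends e) ≡ v)

  IsSink : Position → V → Set
  IsSink p v = ∀ e → Incident e v → Σ Bool λ o → (p e ≡ just o) × (headOf e o ≡ v)

  IsSource : Position → V → Set
  IsSource p v = ∀ e → Incident e v → Σ Bool λ o → (p e ≡ just o) × (tailOf e o ≡ v)

  Legal : Position → E → Bool → Set
  Legal p e o = (p e ≡ nothing)
              × (∀ v → ¬ IsSink (play p e o) v)
              × (∀ v → ¬ IsSource (play p e o) v)

  IsCycleCell : Position → List (E × Bool) → Set
  IsCycleCell p c = All (λ es → p (proj₁ es) ≡ just (proj₂ es)) c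
                  ⊎ All (λ es → p (proj₁ es) ≡ just (not (proj₂ es))) c

  HasCycleCell : Position → Set
  HasCycleCell p = Any (IsCycleCell p) cells

  -- Wins p : the player about to move from p has a winning strategy.
  -- Loses p : the player about to move from p loses against a suitable
  -- strategy of the opponent (every legal move fails to create a cycle
  -- cell and leads to a position won by the opponent; in particular a
  -- player with no legal move loses).
  mutual
    data Wins (p : Position) : Set where
      move : (e : E) (o : Bool) → Legal p e o →
             HasCycleCell (play p e o) ⊎ Loses (play p e o) → Wins p

    data Loses (p : Position) : Set where
      allMoves : (∀ e o → Legal p e o →
                    ¬ HasCycleCell (play p e o) × Wins (play p e o)) → Loses p

Player1Wins : Board → Set
Player1Wins B = Game.Wins B (Game.empty B)

-- The board C₃ · C_n : a triangle a b c and an n-cycle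
-- a = w₀, w₁, …, w_{n-1} sharing only the vertex a, each cycle bounding
-- its own cell.

-- vertices: inj₁ 0 = a, inj₁ 1 = b, inj₁ 2 = c ; inj₂ j = w_{j+1}
Vtx : ℕ → Set
Vtx n = Fin 3 ⊎ Fin (n ∸ 1)

va vb vc : (n : ℕ) → Vtx n
va n = inj₁ f0
vb n = inj₁ (fs f0)
vc n = inj₁ (fs (fs f0))

-- the j-th vertex w_j of the n-cycle (with w₀ = w_n = a)
cv : (n j : ℕ) → Vtx n
cv n zero = va n
cv n (suc j) with j <? (n ∸ 1)
... | yes p = inj₂ (fromℕ< p)
... | no _  = va n

-- edges: inj₁ i = i-th triangle edge (a→b, b→c, c→a);
--        inj₂ i = edge w_i → w_{i+1} of the n-cycle
Edge : ℕ → Set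
Edge n = Fin 3 ⊎ Fin n

triEnds : (n : ℕ) → Fin 3 → Vtx n × Vtx n
triEnds n f0 = va n , vb n
triEnds n (fs f0) = vb n , vc n
triEnds n (fs (fs f0)) = vc n , va n

C3Cn : ℕ → Board
C3Cn n = record
  { V     = Vtx n
  ; E     = Edge n
  ; _≟E_  = ≡-dec _≟F_ _≟F_
  ; ends  = λ { (inj₁ i) → triEnds n i
              ; (inj₂ i) → cv n (toℕ i) , cv n (suc (toℕ i)) }
  ; cells = map (λ i → inj₁ i , true) (allFin 3)
          ∷ map (λ i → inj₂ i , true) (allFin n)
          ∷ []
  }

{-# OPTIONS --safe #-}

-- The reflection of C_n that fixes a sends cycle edge i to edge (opposite i) with its arrow
-- reversed, so Player 1 answers a move on i by the same mark on (opposite i).  This keeps the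
-- position symmetric; in a symmetric position the two cycle edges at a point the same way, so a
-- is neither sink nor source; the mirror move is legal because each vertex it touches is the
-- mirror image of one at which Player 2's move was legal; and Player 2 never closes C_n, since
-- the partner of its move is still open.  For even n no edge is fixed: Player 1 opens with
-- b → c, closes the triangle whenever Player 2 touches it, and mirrors otherwise.  For odd n the
-- middle edge is fixed.  Player 1 opens with a → b and mirrors; the middle edge and the move
-- a → c, after which bc can never be marked, are spare tempo moves: when Player 2 takes one,
-- Player 1 takes the other.  When Player 2's move leaves only its partner and the middle edge
-- open on the cycle, Player 1 plays a → c instead and then takes whichever of the two Player 2
-- leaves.  Either way Player 1 moves last.

module Submission where

open import Defs
open import Data.Nat using (ℕ; zero; suc; _+_; ⌊_/2⌋; _≤_; _<_; _<?_; z≤n; s≤s; s≤s⁻¹)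
open import Data.Nat.Properties
  using (≤-refl; ≤-trans; <⇒≤; <-≤-trans; n≮0; +-mono-≤; +-mono-≤-<; <-irrefl; ≮⇒≥; ≤-antisym;
         1+n≢n; m≢1+n+m; m+[n∸m]≡n; n≡⌊n+n/2⌋)
  renaming (suc-injective to suc-injectiveℕ)
open import Data.Fin using (Fin; toℕ; fromℕ; fromℕ<; inject₁; opposite) renaming (zero to f0; suc to fs)
open import Data.Fin.Properties
  using (toℕ-injective; toℕ<n; toℕ-fromℕ<; fromℕ<-toℕ; toℕ-fromℕ; toℕ-inject₁; opposite-prop;
         opposite-involutive; inject₁-injective; suc-injective; fromℕ≢inject₁; any?)
  renaming (_≟_ to _≟F_)
open import Data.Bool using (Bool; true; false; not) renaming (_≟_ to _≟B_)
open import Data.Maybe using (Maybe; just; nothing; maybe′; fromMaybe)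
open import Data.Maybe.Properties using () renaming (≡-dec to ≡-decMaybe)
open import Data.Product using (Σ; ∃; _×_; _,_; proj₁; proj₂)
open import Data.Sum using (_⊎_; inj₁; inj₂; map₂)
open import Data.Empty using (⊥; ⊥-elim)
open import Data.Unit using (⊤; tt)
open import Data.List using (List; []; _∷_; map; allFin; _++_)
open import Data.List.Relation.Unary.All using ([]; _∷_; all?; lookup)
import Data.List.Relation.Unary.All as All
import Data.List.Relation.Unary.All.Properties as All
open import Data.List.Relation.Unary.Any using (here; there)
open import Data.List.Membership.Propositional using (_∈_)
open import Data.List.Membership.Propositional.Properties using (∈-map⁺; ∈-allFin; ∈-++⁺ˡ; ∈-++⁺ʳ)
open import Relation.Nullary using (¬_; Dec; yes; no)
open import Relation.Nullary.Decidable using (_⊎-dec_; _×-dec_; ¬?)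
open import Relation.Binary.PropositionalEquality using (_≡_; _≢_; refl; sym; trans; cong; subst; subst₂)

-- For the edge entering and the edge leaving a vertex (reference orientations), agreeing
-- marks are exactly those that let the arrows pass through it.
Agree : Maybe Bool → Maybe Bool → Set
Agree (just x) (just y) = x ≡ y
Agree _        _        = ⊤

agree-sym : ∀ u v → Agree u v → Agree v u
agree-sym (just x) (just y) x≡y = sym x≡y
agree-sym (just _) nothing  _   = tt
agree-sym nothing  (just _) _   = tt
agree-sym nothing  nothing  _   = tt

agree-refl : ∀ u → Agree u u
agree-refl (just _) = refl
agree-refl nothing  = tt

agree-blankʳ : ∀ u → Agree u nothing
agree-blankʳ (just _) = tt
agree-blankʳ nothing  = tt

agree-fill : ∀ u → Agree u (just (fromMaybe true u))
agree-fill (just _) = refl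
agree-fill nothing  = tt

agree-trans : ∀ u {v} w → v ≢ nothing → Agree u v → Agree v w → Agree u w
agree-trans (just _) {just _} (just _) _ refl refl = refl
agree-trans (just _) {just _} nothing  _ _    _    = tt
agree-trans nothing  {just _} _        _ _    _    = tt
agree-trans _        {nothing} _       v≢nothing _ _ = ⊥-elim (v≢nothing refl)

agree-marked : ∀ {u v} → Agree u v → u ≢ nothing → v ≢ nothing → u ≡ v
agree-marked {just _} {just _} refl _ _ = refl
agree-marked {nothing} _ u≢nothing _ = ⊥-elim (u≢nothing refl)
agree-marked {just _} {nothing} _ _ v≢nothing = ⊥-elim (v≢nothing refl)

agree-just : ∀ {u v a b} → u ≡ just a → v ≡ just b → Agree u v → a ≡ b
agree-just refl refl a≡b = a≡b

just⇒≢nothing : ∀ {u : Maybe Bool} {a} → u ≡ just a → u ≢ nothing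
just⇒≢nothing refl ()

opposite-inject₁ : ∀ {k} (w : Fin (suc k)) → opposite (inject₁ w) ≡ fs (opposite w)
opposite-inject₁ {k}     f0     = refl
opposite-inject₁ {suc k} (fs w) = cong inject₁ (opposite-inject₁ w)

opposite-swap : ∀ {k} {i j : Fin k} → opposite i ≡ j → i ≡ opposite j
opposite-swap {i = i} eq = trans (sym (opposite-involutive i)) (cong opposite eq)

opposite-injective : ∀ {k} {a b : Fin k} → opposite a ≡ opposite b → a ≡ b
opposite-injective {b = b} eq = trans (opposite-swap eq) (opposite-involutive b)

toℕ-opposite-sum : ∀ {k} (i : Fin (suc k)) → toℕ i + toℕ (opposite i) ≡ k
toℕ-opposite-sum i = trans (cong (toℕ i +_) (opposite-prop i)) (m+[n∸m]≡n (s≤s⁻¹ (toℕ<n i)))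

fixed-point-sum : ∀ {k} {i : Fin (suc k)} → opposite i ≡ i → toℕ i + toℕ i ≡ k
fixed-point-sum {i = i} fixed = trans (cong (λ j → toℕ i + toℕ j) (sym fixed)) (toℕ-opposite-sum i)

double-injective : ∀ {x y} → x + x ≡ y + y → x ≡ y
double-injective {x} {y} eq = trans (n≡⌊n+n/2⌋ x) (trans (cong ⌊_/2⌋ eq) (sym (n≡⌊n+n/2⌋ y)))

inject₁≢suc : ∀ {k} (w : Fin k) → inject₁ w ≢ fs w
inject₁≢suc w eq = 1+n≢n (sym (trans (sym (toℕ-inject₁ w)) (cong toℕ eq)))

module GameProperties (B : Board) where
  open Board B
  open Game B

  startOf endOf : E → V
  startOf e = proj₁ (ends e)
  endOf   e = proj₂ (ends e)

  play-same : ∀ p e o → play p e o e ≡ just o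
  play-same p e o with e ≟E e
  ... | yes _  = refl
  ... | no e≢e = ⊥-elim (e≢e refl)

  play-other : ∀ p e o {e'} → e' ≢ e → play p e o e' ≡ p e'
  play-other p e o {e'} e'≢e with e' ≟E e
  ... | yes e'≡e = ⊥-elim (e'≢e e'≡e)
  ... | no _     = refl

  isCycleCell? : ∀ p c → Dec (IsCycleCell p c)
  isCycleCell? p c = all? (λ (e , d) → ≡-decMaybe _≟B_ (p e) (just d)) c
                 ⊎-dec all? (λ (e , d) → ≡-decMaybe _≟B_ (p e) (just (not d))) c

  blank⇒¬cycleCell : ∀ {q c e d} → (e , d) ∈ c → q e ≡ nothing → ¬ IsCycleCell q c
  blank⇒¬cycleCell e∈c qe (inj₁ clockwise) with trans (sym qe) (lookup clockwise e∈c)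
  ... | ()
  blank⇒¬cycleCell e∈c qe (inj₂ counterclockwise) with trans (sym qe) (lookup counterclockwise e∈c)
  ... | ()

  sink-intro : ∀ {q v} → (∀ e → startOf e ≡ v → q e ≡ just false) →
               (∀ e → endOf e ≡ v → q e ≡ just true) → IsSink q v
  sink-intro at-start at-end e (inj₁ eq) = false , at-start e eq , eq
  sink-intro at-start at-end e (inj₂ eq) = true , at-end e eq , eq

  source-intro : ∀ {q v} → (∀ e → startOf e ≡ v → q e ≡ just true) →
                 (∀ e → endOf e ≡ v → q e ≡ just false) → IsSource q v
  source-intro at-start at-end e (inj₁ eq) = true , at-start e eq , eq
  source-intro at-start at-end e (inj₂ eq) = false , at-end e eq , eq

  blank⇒¬sink : ∀ {q v} e → q e ≡ nothing → Incident e v → ¬ IsSink q v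
  blank⇒¬sink e qe inc sink with sink e inc
  ... | _ , qe′ , _ with trans (sym qe) qe′
  ... | ()

  blank⇒¬source : ∀ {q v} e → q e ≡ nothing → Incident e v → ¬ IsSource q v
  blank⇒¬source e qe inc source with source e inc
  ... | _ , qe′ , _ with trans (sym qe) qe′
  ... | ()

  sink-unaffected : ∀ {q v e o} → ¬ Incident e v → IsSink (play q e o) v → IsSink q v
  sink-unaffected {q} {e = e} {o} ¬incident sink e′ incident with sink e′ incident
  ... | o′ , qe′ , head = o′ , trans (sym (play-other q e o λ { refl → ¬incident incident })) qe′ , head

  source-unaffected : ∀ {q v e o} → ¬ Incident e v → IsSource (play q e o) v → IsSource q v
  source-unaffected {q} {e = e} {o} ¬incident source e′ incident with source e′ incident
  ... | o′ , qe′ , tail = o′ , trans (sym (play-other q e o λ { refl → ¬incident incident })) qe′ , tail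

  module _ (loopless : ∀ e → startOf e ≢ endOf e) where

    sink-start : ∀ {q v e} → IsSink q v → startOf e ≡ v → q e ≡ just false
    sink-start {e = e} sink eq with sink e (inj₁ eq)
    ... | false , qe , _   = qe
    ... | true  , _  , end = ⊥-elim (loopless e (trans eq (sym end)))

    sink-end : ∀ {q v e} → IsSink q v → endOf e ≡ v → q e ≡ just true
    sink-end {e = e} sink eq with sink e (inj₂ eq)
    ... | true  , qe , _     = qe
    ... | false , _  , start = ⊥-elim (loopless e (trans start (sym eq)))

    source-start : ∀ {q v e} → IsSource q v → startOf e ≡ v → q e ≡ just true
    source-start {e = e} source eq with source e (inj₁ eq)
    ... | true  , qe , _   = qe
    ... | false , _  , end = ⊥-elim (loopless e (trans eq (sym end)))

    source-end : ∀ {q v e} → IsSource q v → endOf e ≡ v → q e ≡ just false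
    source-end {e = e} source eq with source e (inj₂ eq)
    ... | false , qe , _     = qe
    ... | true  , _  , start = ⊥-elim (loopless e (trans start (sym eq)))

    record PassesThrough (v : V) (x y : E) : Set where
      field
        end-in     : endOf x ≡ v
        start-out  : startOf y ≡ v
        in-unique  : ∀ e → endOf e ≡ v → e ≡ x
        out-unique : ∀ e → startOf e ≡ v → e ≡ y

    module _ {v x y} (through : PassesThrough v x y) where
      open PassesThrough through

      agree⇒¬sink : ∀ {q} → Agree (q x) (q y) → ¬ IsSink q v
      agree⇒¬sink agree sink with sink-end sink end-in | sink-start sink start-out
      ... | qx | qy rewrite qx | qy with agree
      ... | ()

      agree⇒¬source : ∀ {q} → Agree (q x) (q y) → ¬ IsSource q v
      agree⇒¬source agree source with source-end source end-in | source-start source start-out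
      ... | qx | qy rewrite qx | qy with agree
      ... | ()

      ¬sink×¬source⇒agree : ∀ {q} → ¬ IsSink q v → ¬ IsSource q v → Agree (q x) (q y)
      ¬sink×¬source⇒agree {q} ¬sink ¬source with q x in qx | q y in qy
      ... | just true  | just true  = refl
      ... | just false | just false = refl
      ... | just true  | just false = ⊥-elim (¬sink (sink-intro
              (λ e eq → trans (cong q (out-unique e eq)) qy) (λ e eq → trans (cong q (in-unique e eq)) qx)))
      ... | just false | just true  = ⊥-elim (¬source (source-intro
              (λ e eq → trans (cong q (out-unique e eq)) qy) (λ e eq → trans (cong q (in-unique e eq)) qx)))
      ... | just _     | nothing    = tt
      ... | nothing    | _          = tt

  blank : Maybe Bool → ℕ
  blank = maybe′ (λ _ → 0) 1

  unmarked : Position → List E → ℕ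
  unmarked p []       = 0
  unmarked p (e ∷ es) = blank (p e) + unmarked p es

  blank-play : ∀ p e o e' → blank (play p e o e') ≤ blank (p e')
  blank-play p e o e' with e' ≟E e
  ... | yes _ = z≤n
  ... | no _  = ≤-refl

  unmarked-play-≤ : ∀ p e o es → unmarked (play p e o) es ≤ unmarked p es
  unmarked-play-≤ p e o []        = z≤n
  unmarked-play-≤ p e o (e' ∷ es) = +-mono-≤ (blank-play p e o e') (unmarked-play-≤ p e o es)

  unmarked-play-< : ∀ p e o {es} → p e ≡ nothing → e ∈ es → unmarked (play p e o) es < unmarked p es
  unmarked-play-< p e o {e ∷ es} pe (here refl) rewrite play-same p e o | pe = s≤s (unmarked-play-≤ p e o es)
  unmarked-play-< p e o {e' ∷ es} pe (there e∈es) = +-mono-≤-< (blank-play p e o e') (unmarked-play-< p e o pe e∈es)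

  module Strategies (edges : List E) (∈-edges : ∀ e → e ∈ edges) where

    record Reply (Inv : Position → Set) (q : Position) : Set where
      constructor reply
      field
        edge        : E
        orientation : Bool
        legal       : Legal q edge orientation
        outcome     : HasCycleCell (play q edge orientation) ⊎ Inv (play q edge orientation)

    Answers : (Position → Set) → (Position → Set) → Set
    Answers State Inv = ∀ p → State p → ∀ e o → Legal p e o →
                        ¬ HasCycleCell (play p e o) × Reply Inv (play p e o)

    Strategy : (Position → Set) → Set
    Strategy Inv = Answers Inv Inv

    legal-decreases : ∀ {p e o} → Legal p e o → unmarked (play p e o) edges < unmarked p edges
    legal-decreases {p} {e} {o} (pe , _) = unmarked-play-< p e o pe (∈-edges e)

    strategy⇒loses : ∀ {Inv} → Strategy Inv → ∀ p → Inv p → Loses p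
    strategy⇒loses {Inv} σ p = loses (unmarked p edges) p ≤-refl
      where
      loses : ∀ f p → unmarked p edges ≤ f → Inv p → Loses p
      loses zero    p bound _   = allMoves λ e o L → ⊥-elim (n≮0 (<-≤-trans (legal-decreases L) bound))
      loses (suc f) p bound inv = allMoves answer
        where
        answer : ∀ e o → Legal p e o → ¬ HasCycleCell (play p e o) × Wins (play p e o)
        answer e o L with σ p inv e o L
        ... | noCycle , reply e′ o′ L′ outcome = noCycle , move e′ o′ L′ (map₂ (loses f _ two-moves) outcome)
          where
          two-moves : unmarked (play (play p e o) e′ o′) edges ≤ f
          two-moves = <⇒≤ (<-≤-trans (legal-decreases L′) (s≤s⁻¹ (<-≤-trans (legal-decreases L) bound)))

    reply⇒wins : ∀ {Inv p} → Strategy Inv → Reply Inv p → Wins p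
    reply⇒wins σ (reply e o L outcome) = move e o L (map₂ (strategy⇒loses σ _) outcome)

module C3CnProperties (m : ℕ) where

  n : ℕ
  n = suc (suc m)

  open Game (C3Cn n) public
  open GameProperties (C3Cn n) public

  ab bc ca : Edge n
  ab = inj₁ f0
  bc = inj₁ (fs f0)
  ca = inj₁ (fs (fs f0))

  first last : Fin n
  first = f0
  last  = fromℕ (suc m)

  cv-interior : (w : Fin (suc m)) → cv n (suc (toℕ w)) ≡ inj₂ w
  cv-interior w with toℕ w <? suc m
  ... | yes lt = cong inj₂ (fromℕ<-toℕ w lt)
  ... | no ¬lt = ⊥-elim (¬lt (toℕ<n w))

  cv-end : cv n n ≡ va n
  cv-end with suc m <? suc m
  ... | yes lt = ⊥-elim (<-irrefl refl lt)
  ... | no _   = refl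

  cv≡interior : ∀ t {w} → cv n t ≡ inj₂ w → t ≡ suc (toℕ w)
  cv≡interior (suc t) eq with t <? suc m
  cv≡interior (suc t) refl | yes lt = cong suc (sym (toℕ-fromℕ< lt))

  cv≡triangle : ∀ t {x} → cv n t ≡ inj₁ x → x ≡ f0 × (t ≡ 0 ⊎ n ≤ t)
  cv≡triangle zero    refl = refl , inj₁ refl
  cv≡triangle (suc t) eq with t <? suc m
  cv≡triangle (suc t) refl | no ¬lt = refl , inj₂ (s≤s (≮⇒≥ ¬lt))

  start-first : startOf (inj₂ first) ≡ va n
  start-first = refl

  end-last : endOf (inj₂ last) ≡ va n
  end-last = subst (λ t → cv n (suc t) ≡ va n) (sym (toℕ-fromℕ (suc m))) cv-end

  start-suc : ∀ w → startOf (inj₂ (fs w)) ≡ inj₂ w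
  start-suc = cv-interior

  end-inject₁ : ∀ w → endOf (inj₂ (inject₁ w)) ≡ inj₂ w
  end-inject₁ w = subst (λ t → cv n (suc t) ≡ inj₂ w) (sym (toℕ-inject₁ w)) (cv-interior w)

  start≡interior : ∀ i {w} → startOf (inj₂ i) ≡ inj₂ w → i ≡ fs w
  start≡interior i eq = toℕ-injective (cv≡interior (toℕ i) eq)

  end≡interior : ∀ i {w} → endOf (inj₂ i) ≡ inj₂ w → i ≡ inject₁ w
  end≡interior i eq = toℕ-injective (trans (suc-injectiveℕ (cv≡interior (suc (toℕ i)) eq)) (sym (toℕ-inject₁ _)))

  start≡triangle : ∀ i {x} → startOf (inj₂ i) ≡ inj₁ x → x ≡ f0 × i ≡ first
  start≡triangle i eq with cv≡triangle (toℕ i) eq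
  ... | x≡a , inj₁ i≡0 = x≡a , toℕ-injective i≡0
  ... | _   , inj₂ n≤i = ⊥-elim (<-irrefl refl (≤-trans (toℕ<n i) n≤i))

  end≡triangle : ∀ i {x} → endOf (inj₂ i) ≡ inj₁ x → x ≡ f0 × i ≡ last
  end≡triangle i eq with cv≡triangle (suc (toℕ i)) eq
  ... | x≡a , inj₂ n≤1+i =
    x≡a , toℕ-injective (trans (≤-antisym (s≤s⁻¹ (toℕ<n i)) (s≤s⁻¹ n≤1+i)) (sym (toℕ-fromℕ (suc m))))

  loopless : ∀ e → startOf e ≢ endOf e
  loopless (inj₁ f0) ()
  loopless (inj₁ (fs f0)) ()
  loopless (inj₁ (fs (fs f0))) ()
  loopless (inj₂ i) loop with startOf (inj₂ i) in start
  ... | inj₁ _ with proj₂ (start≡triangle i start) | proj₂ (end≡triangle i (sym loop))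
  ...   | refl | ()
  loopless (inj₂ i) loop | inj₂ w =
    1+n≢n (trans (cong toℕ (trans (sym (start≡interior i start)) (end≡interior i (sym loop)))) (toℕ-inject₁ w))

  through-b : PassesThrough loopless (vb n) ab bc
  through-b = record { end-in = refl ; start-out = refl ; in-unique = in-b ; out-unique = out-b }
    where
    in-b : ∀ e → endOf e ≡ vb n → e ≡ ab
    in-b (inj₁ f0) _ = refl
    in-b (inj₁ (fs f0)) ()
    in-b (inj₁ (fs (fs f0))) ()
    in-b (inj₂ i) eq with proj₁ (end≡triangle i eq)
    ... | ()
    out-b : ∀ e → startOf e ≡ vb n → e ≡ bc
    out-b (inj₁ (fs f0)) _ = refl
    out-b (inj₁ (fs (fs f0))) ()
    out-b (inj₂ i) eq with proj₁ (start≡triangle i eq)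
    ... | ()

  through-c : PassesThrough loopless (vc n) bc ca
  through-c = record { end-in = refl ; start-out = refl ; in-unique = in-c ; out-unique = out-c }
    where
    in-c : ∀ e → endOf e ≡ vc n → e ≡ bc
    in-c (inj₁ (fs f0)) _ = refl
    in-c (inj₁ (fs (fs f0))) ()
    in-c (inj₂ i) eq with proj₁ (end≡triangle i eq)
    ... | ()
    out-c : ∀ e → startOf e ≡ vc n → e ≡ ca
    out-c (inj₁ (fs (fs f0))) _ = refl
    out-c (inj₂ i) eq with proj₁ (start≡triangle i eq)
    ... | ()

  through-interior : ∀ w → PassesThrough loopless (inj₂ w) (inj₂ (inject₁ w)) (inj₂ (fs w))
  through-interior w = record
    { end-in     = end-inject₁ w
    ; start-out  = start-suc w
    ; in-unique  = λ { (inj₁ f0) () ; (inj₁ (fs f0)) () ; (inj₁ (fs (fs f0))) ()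
                     ; (inj₂ i) eq → cong inj₂ (end≡interior i eq) }
    ; out-unique = λ { (inj₁ f0) () ; (inj₁ (fs f0)) () ; (inj₁ (fs (fs f0))) ()
                     ; (inj₂ i) eq → cong inj₂ (start≡interior i eq) }
    }

  -- The interior vertex inj₂ w is entered by cycle edge inject₁ w and left by fs w.
  AgreeAt : Position → Fin (suc m) → Set
  AgreeAt q w = Agree (q (inj₂ (inject₁ w))) (q (inj₂ (fs w)))

  CycleAgree : Position → Set
  CycleAgree q = ∀ w → AgreeAt q w

  record Consistent (q : Position) : Set where
    field
      at-b        : Agree (q ab) (q bc)
      at-c        : Agree (q bc) (q ca)
      along-cycle : CycleAgree q
      ¬sink-a     : ¬ IsSink q (va n)
      ¬source-a   : ¬ IsSource q (va n)

  legal⇒consistent : ∀ {p e o} → Legal p e o → Consistent (play p e o)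
  legal⇒consistent (_ , ¬sink , ¬source) = record
    { at-b        = ¬sink×¬source⇒agree loopless through-b (¬sink (vb n)) (¬source (vb n))
    ; at-c        = ¬sink×¬source⇒agree loopless through-c (¬sink (vc n)) (¬source (vc n))
    ; along-cycle = λ w → ¬sink×¬source⇒agree loopless (through-interior w) (¬sink (inj₂ w)) (¬source (inj₂ w))
    ; ¬sink-a     = ¬sink (va n)
    ; ¬source-a   = ¬source (va n)
    }

  consistent⇒legal : ∀ {p e o} → p e ≡ nothing → Consistent (play p e o) → Legal p e o
  consistent⇒legal blank consistent = blank , no-sink , no-source
    where
    open Consistent consistent
    no-sink : ∀ v → ¬ IsSink _ v
    no-sink (inj₁ f0)           = ¬sink-a
    no-sink (inj₁ (fs f0))      = agree⇒¬sink loopless through-b at-b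
    no-sink (inj₁ (fs (fs f0))) = agree⇒¬sink loopless through-c at-c
    no-sink (inj₂ w)            = agree⇒¬sink loopless (through-interior w) (along-cycle w)
    no-source : ∀ v → ¬ IsSource _ v
    no-source (inj₁ f0)           = ¬source-a
    no-source (inj₁ (fs f0))      = agree⇒¬source loopless through-b at-b
    no-source (inj₁ (fs (fs f0))) = agree⇒¬source loopless through-c at-c
    no-source (inj₂ w)            = agree⇒¬source loopless (through-interior w) (along-cycle w)

  ab-out⇒¬sink-a : ∀ {q} → q ab ≡ just true → ¬ IsSink q (va n)
  ab-out⇒¬sink-a qab sink with trans (sym qab) (sink-start loopless {e = ab} sink refl)
  ... | ()

  ca-in⇒¬source-a : ∀ {q} → q ca ≡ just true → ¬ IsSource q (va n)
  ca-in⇒¬source-a qca source with trans (sym qca) (source-end loopless {e = ca} source refl)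
  ... | ()

  ends-agree⇒¬sink-a : ∀ {q} → Agree (q (inj₂ first)) (q (inj₂ last)) → ¬ IsSink q (va n)
  ends-agree⇒¬sink-a {q} agree sink
    with sink-start loopless {e = inj₂ first} sink start-first | sink-end loopless {e = inj₂ last} sink end-last
  ... | q-first | q-last rewrite q-first | q-last with agree
  ... | ()

  ends-agree⇒¬source-a : ∀ {q} → Agree (q (inj₂ first)) (q (inj₂ last)) → ¬ IsSource q (va n)
  ends-agree⇒¬source-a {q} agree source
    with source-start loopless {e = inj₂ first} source start-first
       | source-end loopless {e = inj₂ last} source end-last
  ... | q-first | q-last rewrite q-first | q-last with agree
  ... | ()

  triangleCell cycleCell : List (Edge n × Bool)
  triangleCell = map (λ i → inj₁ i , true) (allFin 3)
  cycleCell    = map (λ i → inj₂ i , true) (allFin n)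

  noCycleCell : ∀ {q} → ¬ IsCycleCell q triangleCell → ¬ IsCycleCell q cycleCell → ¬ HasCycleCell q
  noCycleCell ¬triangle ¬cycle (here triangle)       = ¬triangle triangle
  noCycleCell ¬triangle ¬cycle (there (here cycle)) = ¬cycle cycle

  blank-triangle : ∀ {q} t → q (inj₁ t) ≡ nothing → ¬ IsCycleCell q triangleCell
  blank-triangle t = blank⇒¬cycleCell (∈-map⁺ (λ i → inj₁ i , true) (∈-allFin t))

  blank-cycle : ∀ {q} i → q (inj₂ i) ≡ nothing → ¬ IsCycleCell q cycleCell
  blank-cycle i = blank⇒¬cycleCell (∈-map⁺ (λ i → inj₂ i , true) (∈-allFin i))

  -- In a blocked position bc can never be marked: it would have to point away from both b and c.
  Blocked : Position → Set
  Blocked q = q ab ≡ just true × q ca ≡ just false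

  blocked-triangle : ∀ {q} → Blocked q → ¬ IsCycleCell q triangleCell
  blocked-triangle (qab , qca) (inj₁ (_ ∷ _ ∷ qca′ ∷ [])) with trans (sym qca) qca′
  ... | ()
  blocked-triangle (qab , qca) (inj₂ (qab′ ∷ _)) with trans (sym qab) qab′
  ... | ()

  triangle-cycle : ∀ {q} → q ab ≡ just true → q bc ≡ just true → q ca ≡ just true → HasCycleCell q
  triangle-cycle qab qbc qca = here (inj₁ (qab ∷ qbc ∷ qca ∷ []))

  cycleCell-cong : ∀ {p q} → (∀ i → q (inj₂ i) ≡ p (inj₂ i)) →
                  IsCycleCell q cycleCell → IsCycleCell p cycleCell
  cycleCell-cong q≡p (inj₁ clockwise) =
    inj₁ (All.map⁺ (All.map (λ {i} qi → trans (sym (q≡p i)) qi) (All.map⁻ clockwise)))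
  cycleCell-cong q≡p (inj₂ counterclockwise) =
    inj₂ (All.map⁺ (All.map (λ {i} qi → trans (sym (q≡p i)) qi) (All.map⁻ counterclockwise)))

  play-cycle-other : ∀ {q e x a} → a ≢ e → play q (inj₂ e) x (inj₂ a) ≡ q (inj₂ a)
  play-cycle-other {q} {e} {x} a≢e = play-other q (inj₂ e) x λ { refl → a≢e refl }

  -- Equal marks on i and opposite i: the reflection fixing a maps one arrow onto the reverse of
  -- the other.
  Symmetric : Position → Set
  Symmetric q = ∀ i → q (inj₂ (opposite i)) ≡ q (inj₂ i)

  SymmetricOff : Fin n → Position → Set
  SymmetricOff i q = ∀ a → a ≢ i → a ≢ opposite i → q (inj₂ (opposite a)) ≡ q (inj₂ a)

  symmetric⇒symmetricOff : ∀ {q} i → Symmetric q → SymmetricOff i q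
  symmetric⇒symmetricOff i symmetric a _ _ = symmetric a

  symmetric⇒ends-agree : ∀ {q} → Symmetric q → Agree (q (inj₂ first)) (q (inj₂ last))
  symmetric⇒ends-agree {q} symmetric = subst (Agree (q (inj₂ first))) (sym (symmetric first)) (agree-refl _)

  symmetricOff⇒ends-agree : ∀ {q i} → SymmetricOff i q → q (inj₂ (opposite i)) ≡ nothing →
                            Agree (q (inj₂ first)) (q (inj₂ last))
  symmetricOff⇒ends-agree {q} {i} off blank with first ≟F i | first ≟F opposite i
  ... | yes refl | _        = subst (Agree (q (inj₂ first))) (sym blank) (agree-blankʳ _)
  ... | no _     | yes ≡j   =
    subst (λ u → Agree u (q (inj₂ last))) (sym (trans (cong (λ e → q (inj₂ e)) ≡j) blank)) tt
  ... | no ≢i    | no ≢j    = subst (Agree (q (inj₂ first))) (sym (off first ≢i ≢j)) (agree-refl _)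

  play-fixed-preserves : ∀ {q e x} → opposite e ≡ e → ∀ a → q (inj₂ (opposite a)) ≡ q (inj₂ a) →
                         play q (inj₂ e) x (inj₂ (opposite a)) ≡ play q (inj₂ e) x (inj₂ a)
  play-fixed-preserves {q} {e} {x} fixed a qa = by-cases (a ≟F e)
    where
    by-cases : Dec (a ≡ e) → play q (inj₂ e) x (inj₂ (opposite a)) ≡ play q (inj₂ e) x (inj₂ a)
    by-cases (yes refl) = cong (λ i → play q (inj₂ a) x (inj₂ i)) fixed
    by-cases (no a≢e)   = trans (play-cycle-other λ eq → a≢e (trans (opposite-swap eq) fixed))
                                (trans qa (sym (play-cycle-other a≢e)))

  symmetric-play-fixed : ∀ {q e x} → opposite e ≡ e → Symmetric q → Symmetric (play q (inj₂ e) x)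
  symmetric-play-fixed fixed symmetric a = play-fixed-preserves fixed a (symmetric a)

  symmetricOff-play-fixed : ∀ {q i e x} → opposite e ≡ e → SymmetricOff i q → SymmetricOff i (play q (inj₂ e) x)
  symmetricOff-play-fixed fixed off a a≢i a≢j = play-fixed-preserves fixed a (off a a≢i a≢j)

  symmetricOff-play-pair : ∀ {q i e x} → e ≡ i ⊎ e ≡ opposite i → SymmetricOff i q →
                           SymmetricOff i (play q (inj₂ e) x)
  symmetricOff-play-pair {i = i} e∈pair off a a≢i a≢j =
    trans (play-cycle-other (opposite-a∉pair e∈pair))
          (trans (off a a≢i a≢j) (sym (play-cycle-other (a∉pair e∈pair))))
    where
    a∉pair : ∀ {e} → e ≡ i ⊎ e ≡ opposite i → a ≢ e
    a∉pair (inj₁ refl) = a≢i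
    a∉pair (inj₂ refl) = a≢j
    opposite-a∉pair : ∀ {e} → e ≡ i ⊎ e ≡ opposite i → opposite a ≢ e
    opposite-a∉pair (inj₁ refl) eq = a≢j (opposite-swap eq)
    opposite-a∉pair (inj₂ refl) eq = a≢i (trans (opposite-swap eq) (opposite-involutive i))

  agreeAt-opposite : ∀ {q} → Symmetric q → ∀ w → AgreeAt q (opposite w) → AgreeAt q w
  agreeAt-opposite {q} symmetric w agree = agree-sym _ _ (subst₂ Agree (symmetric (fs w))
    (trans (cong (λ e → q (inj₂ e)) (sym (opposite-inject₁ w))) (symmetric (inject₁ w))) agree)

  play-untouched : ∀ {s e x} → CycleAgree s → ∀ w → inject₁ w ≢ e → fs w ≢ e →
                   AgreeAt (play s (inj₂ e) x) w
  play-untouched agree w in≢e out≢e =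
    subst₂ Agree (sym (play-cycle-other in≢e)) (sym (play-cycle-other out≢e)) (agree w)

  mirror-at : ∀ {s i o} → s (inj₂ i) ≡ just o → play s (inj₂ (opposite i)) o (inj₂ i) ≡ just o
  mirror-at {s} {i} {o} si = by-cases (i ≟F opposite i)
    where
    by-cases : Dec (i ≡ opposite i) → play s (inj₂ (opposite i)) o (inj₂ i) ≡ just o
    by-cases (yes i≡j) = trans (cong (λ e → play s (inj₂ (opposite i)) o (inj₂ e)) i≡j)
                               (play-same s (inj₂ (opposite i)) o)
    by-cases (no i≢j)  = trans (play-cycle-other i≢j) si

  mirror-symmetric : ∀ {s i o} → SymmetricOff i s → s (inj₂ i) ≡ just o →
                     Symmetric (play s (inj₂ (opposite i)) o)
  mirror-symmetric {s} {i} {o} off si a = by-cases (a ≟F i) (a ≟F opposite i)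
    where
    s′ = play s (inj₂ (opposite i)) o
    by-cases : Dec (a ≡ i) → Dec (a ≡ opposite i) → s′ (inj₂ (opposite a)) ≡ s′ (inj₂ a)
    by-cases (yes refl) _        = trans (play-same s (inj₂ (opposite i)) o) (sym (mirror-at {s} {i} si))
    by-cases (no _)     (yes refl) = trans (cong (λ e → s′ (inj₂ e)) (opposite-involutive i))
                                           (trans (mirror-at {s} {i} si) (sym (play-same s (inj₂ (opposite i)) o)))
    by-cases (no a≢i)   (no a≢j) = trans (play-cycle-other (λ eq → a≢i (opposite-injective eq)))
                                         (trans (off a a≢i a≢j) (sym (play-cycle-other a≢j)))

  -- A vertex touching the new edge j but not i is checked at its mirror image, which the move
  -- leaves untouched.
  mirror-agree : ∀ {s i o} → SymmetricOff i s → s (inj₂ i) ≡ just o → s (inj₂ (opposite i)) ≡ nothing →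
                 CycleAgree s → CycleAgree (play s (inj₂ (opposite i)) o)
  mirror-agree {s} {i} {o} off si sj agree w =
    by-cases (inject₁ w ≟F opposite i) (fs w ≟F opposite i) (inject₁ w ≟F i) (fs w ≟F i)
    where
    j  = opposite i
    s′ = play s (inj₂ j) o
    i≢j : i ≢ j
    i≢j i≡j with trans (sym si) (trans (cong (λ e → s (inj₂ e)) i≡j) sj)
    ... | ()
    pair-value : ∀ {e} → e ≡ i ⊎ e ≡ j → s′ (inj₂ e) ≡ just o
    pair-value (inj₁ refl) = mirror-at {s} {i} si
    pair-value (inj₂ refl) = play-same s (inj₂ (opposite i)) o
    both-in-pair : inject₁ w ≡ i ⊎ inject₁ w ≡ j → fs w ≡ i ⊎ fs w ≡ j → AgreeAt s′ w
    both-in-pair x∈ y∈ = subst₂ Agree (sym (pair-value x∈)) (sym (pair-value y∈)) refl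
    by-cases : Dec (inject₁ w ≡ j) → Dec (fs w ≡ j) → Dec (inject₁ w ≡ i) → Dec (fs w ≡ i) → AgreeAt s′ w
    by-cases (no x≢j)  (no y≢j)  _          _          = play-untouched {s} {j} {o} agree w x≢j y≢j
    by-cases _         _         (no x≢i)   (no y≢i)   = agreeAt-opposite {s′} (mirror-symmetric {s} {i} {o} off si) w
      (play-untouched {s} {j} {o} agree (opposite w) (λ eq → y≢i (opposite-injective eq))
                                        (λ eq → x≢i (opposite-injective (trans (opposite-inject₁ w) eq))))
    by-cases (yes x≡j) _         (yes x≡i)  _          = ⊥-elim (i≢j (trans (sym x≡i) x≡j))
    by-cases (yes x≡j) _         (no _)     (yes y≡i)  = both-in-pair (inj₂ x≡j) (inj₁ y≡i)
    by-cases (no _)    (yes y≡j) (yes x≡i)  _          = both-in-pair (inj₁ x≡i) (inj₂ y≡j)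
    by-cases (no _)    (yes y≡j) (no _)     (yes y≡i)  = ⊥-elim (i≢j (trans (sym y≡i) y≡j))

  agree-mark-between : ∀ {s w₀ w₁} → fs w₀ ≡ inject₁ w₁ → CycleAgree s →
                       s (inj₂ (inject₁ w₀)) ≡ s (inj₂ (fs w₁)) →
                       CycleAgree (play s (inj₂ (fs w₀)) (fromMaybe true (s (inj₂ (inject₁ w₀)))))
  agree-mark-between {s} {w₀} {w₁} e≡ agree same w = by-cases (inject₁ w ≟F fs w₀) (fs w ≟F fs w₀)
    where
    x  = fromMaybe true (s (inj₂ (inject₁ w₀)))
    s′ = play s (inj₂ (fs w₀)) x
    at-w₀ : AgreeAt s′ w₀
    at-w₀ = subst₂ Agree (sym (play-cycle-other (inject₁≢suc w₀))) (sym (play-same s (inj₂ (fs w₀)) x))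
                         (agree-fill _)
    at-w₁ : AgreeAt s′ w₁
    at-w₁ = subst₂ Agree (sym (trans (cong (λ e → s′ (inj₂ e)) (sym e≡)) (play-same s (inj₂ (fs w₀)) x)))
                         (sym (play-cycle-other (λ eq → inject₁≢suc w₁ (sym (trans eq e≡)))))
                         (subst (Agree (just x)) same (agree-sym _ _ (agree-fill _)))
    by-cases : Dec (inject₁ w ≡ fs w₀) → Dec (fs w ≡ fs w₀) → AgreeAt s′ w
    by-cases (no in≢e)  (no out≢e) = play-untouched {s} {fs w₀} {x} agree w in≢e out≢e
    by-cases _          (yes out≡e) = subst (AgreeAt s′) (sym (suc-injective out≡e)) at-w₀
    by-cases (yes in≡e) (no _)      = subst (AgreeAt s′) (sym (inject₁-injective (trans in≡e e≡))) at-w₁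

  complete-mirror : ∀ {s i o} → SymmetricOff i s → s (inj₂ i) ≡ just o → s (inj₂ (opposite i)) ≡ nothing →
                    Consistent s → Legal s (inj₂ (opposite i)) o × Symmetric (play s (inj₂ (opposite i)) o)
  complete-mirror {s} {i} {o} off si sj consistent = consistent⇒legal sj consistent′ , symmetric′
    where
    open Consistent consistent
    symmetric′ = mirror-symmetric {s} {i} {o} off si
    consistent′ : Consistent (play s (inj₂ (opposite i)) o)
    consistent′ = record
      { at-b        = at-b
      ; at-c        = at-c
      ; along-cycle = mirror-agree {s} {i} {o} off si sj along-cycle
      ; ¬sink-a     = ends-agree⇒¬sink-a (symmetric⇒ends-agree {play s (inj₂ (opposite i)) o} symmetric′)
      ; ¬source-a   = ends-agree⇒¬source-a (symmetric⇒ends-agree {play s (inj₂ (opposite i)) o} symmetric′)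
      }

  mirrored : Position → Fin n → Bool → Position
  mirrored p i o = play (play p (inj₂ i) o) (inj₂ (opposite i)) o

  symmetricOff-after : ∀ {p} i o → Symmetric p → SymmetricOff i (play p (inj₂ i) o)
  symmetricOff-after {p} i o symmetric =
    symmetricOff-play-pair {p} {i} {i} {o} (inj₁ refl) (symmetric⇒symmetricOff {p} i symmetric)

  partner-blank-after : ∀ {p i o} → Symmetric p → Legal p (inj₂ i) o → opposite i ≢ i →
                        play p (inj₂ i) o (inj₂ (opposite i)) ≡ nothing
  partner-blank-after symmetric L j≢i = trans (play-cycle-other j≢i) (trans (symmetric _) (proj₁ L))

  mirror-reply : ∀ {p i o} → Symmetric p → Legal p (inj₂ i) o → opposite i ≢ i →
                 Legal (play p (inj₂ i) o) (inj₂ (opposite i)) o × Symmetric (mirrored p i o)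
  mirror-reply {p} {i} {o} symmetric L j≢i = complete-mirror {play p (inj₂ i) o} {i} {o}
    (symmetricOff-after i o symmetric) (play-same p (inj₂ i) o) (partner-blank-after {p} symmetric L j≢i)
    (legal⇒consistent L)

  edges : List (Edge n)
  edges = map inj₁ (allFin 3) ++ map inj₂ (allFin n)

  ∈-edges : ∀ e → e ∈ edges
  ∈-edges (inj₁ t) = ∈-++⁺ˡ (∈-map⁺ inj₁ (∈-allFin t))
  ∈-edges (inj₂ i) = ∈-++⁺ʳ (map inj₁ (allFin 3)) (∈-map⁺ inj₂ (∈-allFin i))

  open Strategies edges ∈-edges public

  triangle-reply : ∀ {Inv q} t → q (inj₁ t) ≡ nothing → CycleAgree q →
                   play q (inj₁ t) true ab ≡ just true → play q (inj₁ t) true bc ≡ just true →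
                   play q (inj₁ t) true ca ≡ just true → Reply Inv q
  triangle-reply t blank agree qab qbc qca = reply (inj₁ t) true
    (consistent⇒legal blank record
      { at-b        = subst₂ Agree (sym qab) (sym qbc) refl
      ; at-c        = subst₂ Agree (sym qbc) (sym qca) refl
      ; along-cycle = agree
      ; ¬sink-a     = ab-out⇒¬sink-a qab
      ; ¬source-a   = ca-in⇒¬source-a qca
      })
    (inj₁ (triangle-cycle qab qbc qca))

  blocked-move : ∀ {p e o} → Blocked p → Legal p e o → Σ (Fin n) λ i → e ≡ inj₂ i
  blocked-move {e = inj₁ f0} (pab , _) (blank , _) with () ← trans (sym pab) blank
  blocked-move {p} {inj₁ (fs f0)} {o} (pab , pca) L
    with () ← trans (agree-just pab (play-same p bc o) (Consistent.at-b (legal⇒consistent L)))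
                    (agree-just (play-same p bc o) pca (Consistent.at-c (legal⇒consistent L)))
  blocked-move {e = inj₁ (fs (fs f0))} (_ , pca) (blank , _) with () ← trans (sym pca) blank
  blocked-move {e = inj₂ i} _ _ = i , refl

  interior-¬incident-a : ∀ {w₀ w₁} → fs w₀ ≡ inject₁ w₁ → ¬ Incident (inj₂ (fs w₀)) (va n)
  interior-¬incident-a e≡ (inj₁ start) with proj₂ (start≡triangle _ start)
  ... | ()
  interior-¬incident-a e≡ (inj₂ end) = fromℕ≢inject₁ (trans (sym (proj₂ (end≡triangle _ end))) e≡)

  fill-between : ∀ {s w₀ w₁} → fs w₀ ≡ inject₁ w₁ → Consistent s → s (inj₂ (fs w₀)) ≡ nothing →
                 s (inj₂ (inject₁ w₀)) ≡ s (inj₂ (fs w₁)) →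
                 Legal s (inj₂ (fs w₀)) (fromMaybe true (s (inj₂ (inject₁ w₀))))
  fill-between {s} e≡ consistent blank same = consistent⇒legal blank record
    { at-b        = at-b
    ; at-c        = at-c
    ; along-cycle = agree-mark-between {s} e≡ along-cycle same
    ; ¬sink-a     = λ sink → ¬sink-a (sink-unaffected (interior-¬incident-a e≡) sink)
    ; ¬source-a   = λ source → ¬source-a (source-unaffected (interior-¬incident-a e≡) source)
    }
    where open Consistent consistent

  block-triangle : ∀ {q} → q ab ≡ just true → q bc ≡ nothing → q ca ≡ nothing → CycleAgree q →
                   Agree (q (inj₂ first)) (q (inj₂ last)) → Legal q ca false
  block-triangle qab qbc qca agree ends = consistent⇒legal qca record
    { at-b        = subst₂ Agree (sym qab) (sym qbc) tt
    ; at-c        = subst (λ u → Agree u (just false)) (sym qbc) tt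
    ; along-cycle = agree
    ; ¬sink-a     = ab-out⇒¬sink-a qab
    ; ¬source-a   = ends-agree⇒¬source-a ends
    }

module EvenStrategy (m : ℕ) (no-fixed : ∀ (i : Fin (suc (suc m))) → opposite i ≢ i) where
  open C3CnProperties m

  record EvenPosition (p : Position) : Set where
    field
      ab-blank  : p ab ≡ nothing
      ca-blank  : p ca ≡ nothing
      bc-marked : p bc ≡ just true
      symmetric : Symmetric p
      no-cycle  : ¬ IsCycleCell p cycleCell

  even-strategy : Strategy EvenPosition
  even-strategy p position = respond
    where
    open EvenPosition position
    cycle-unchanged : ∀ {t o} → ¬ IsCycleCell (play p (inj₁ t) o) cycleCell
    cycle-unchanged = λ cycle → no-cycle (cycleCell-cong {p} (λ _ → refl) cycle)
    respond : ∀ e o → Legal p e o → ¬ HasCycleCell (play p e o) × Reply EvenPosition (play p e o)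
    respond (inj₁ f0) o L with agree-just (play-same p ab o) bc-marked (Consistent.at-b (legal⇒consistent L))
    ... | refl = noCycleCell (blank-triangle (fs (fs f0)) ca-blank) cycle-unchanged
               , triangle-reply (fs (fs f0)) ca-blank (Consistent.along-cycle (legal⇒consistent L)) refl bc-marked refl
    respond (inj₁ (fs f0)) o (blank , _) with () ← trans (sym bc-marked) blank
    respond (inj₁ (fs (fs f0))) o L with agree-just bc-marked (play-same p ca o) (Consistent.at-c (legal⇒consistent L))
    ... | refl = noCycleCell (blank-triangle f0 ab-blank) cycle-unchanged
               , triangle-reply f0 ab-blank (Consistent.along-cycle (legal⇒consistent L)) refl bc-marked refl
    respond (inj₂ i) o L = noCycleCell (blank-triangle f0 ab-blank) (blank-cycle (opposite i) (proj₁ (proj₁ mirror)))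
                         , reply (inj₂ (opposite i)) o (proj₁ mirror) outcome
      where
      mirror = mirror-reply {p} {i} {o} symmetric L (no-fixed i)
      outcome : HasCycleCell (mirrored p i o) ⊎ EvenPosition (mirrored p i o)
      outcome with isCycleCell? (mirrored p i o) cycleCell
      ... | yes cycle = inj₁ (there (here cycle))
      ... | no ¬cycle = inj₂ record { ab-blank = ab-blank ; ca-blank = ca-blank ; bc-marked = bc-marked
                                    ; symmetric = proj₂ mirror ; no-cycle = ¬cycle }

  first-move : Reply EvenPosition empty
  first-move = reply bc true
    (consistent⇒legal refl record
      { at-b = tt ; at-c = tt ; along-cycle = λ _ → tt
      ; ¬sink-a   = blank⇒¬sink (inj₂ first) refl (inj₁ refl)
      ; ¬source-a = blank⇒¬source (inj₂ first) refl (inj₁ refl) })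
    (inj₂ record { ab-blank = refl ; ca-blank = refl ; bc-marked = refl
                 ; symmetric = λ _ → refl ; no-cycle = blank-cycle first refl })

  player1Wins : Player1Wins (C3Cn n)
  player1Wins = reply⇒wins even-strategy first-move

-- The cycle edge fixed by opposite is written fs (fs v): for n ≥ 4 it is not among the first
-- two edges, so its neighbour left has a further neighbour below.
module OddStrategy (m : ℕ) (v : Fin m) (fixed : opposite {suc (suc m)} (fs (fs v)) ≡ fs (fs v)) where
  open C3CnProperties m

  middle : Fin n
  middle = fs (fs v)

  w₀ w₁ : Fin (suc m)
  w₀ = fs v
  w₁ = opposite w₀

  middle≡ : fs w₀ ≡ inject₁ w₁
  middle≡ = sym fixed

  left right below : Fin n
  left  = inject₁ w₀
  right = fs w₁
  below = inject₁ (inject₁ v)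

  opposite-left : opposite left ≡ right
  opposite-left = opposite-inject₁ w₀

  fixed-unique : ∀ {i} → opposite i ≡ i → i ≡ middle
  fixed-unique fix = toℕ-injective (double-injective (trans (fixed-point-sum fix) (sym (fixed-point-sum fixed))))

  opposite-≢middle : ∀ {i} → i ≢ middle → opposite i ≢ middle
  opposite-≢middle i≢middle eq = i≢middle (trans (opposite-swap eq) fixed)

  toℕ-below : toℕ below ≡ toℕ v
  toℕ-below = trans (toℕ-inject₁ (inject₁ v)) (toℕ-inject₁ v)

  below≢middle : below ≢ middle
  below≢middle eq = m≢1+n+m (toℕ v) (trans (sym toℕ-below) (cong toℕ eq))

  below≢left : below ≢ left
  below≢left eq = 1+n≢n (sym (trans (sym toℕ-below) (trans (cong toℕ eq) (cong suc (toℕ-inject₁ v)))))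

  below≢right : below ≢ right
  below≢right eq = m≢1+n+m (toℕ v)
    (trans (sym toℕ-below)
           (trans (cong toℕ eq) (cong suc (trans (sym (toℕ-inject₁ w₁)) (cong toℕ (sym middle≡))))))

  left≢middle : left ≢ middle
  left≢middle = inject₁≢suc w₀

  right≢middle : right ≢ middle
  right≢middle eq = inject₁≢suc w₁ (sym (trans eq middle≡))

  -- For the case where left and right carry Player 2's pair of moves, which symmetry does not
  -- relate: both agree with the marked edge below and its mirror image.
  flanks-equal : ∀ {s} → CycleAgree s → s (inj₂ (opposite below)) ≡ s (inj₂ below) →
                 (∀ u → u ≢ middle → s (inj₂ u) ≢ nothing) → s (inj₂ left) ≡ s (inj₂ right)
  flanks-equal {s} agree mirror-below marked-off-middle =
    agree-marked (agree-trans (s (inj₂ left)) (s (inj₂ right)) (marked-off-middle below below≢middle)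
                   (agree-sym _ _ (agree (inject₁ v)))
                   (subst (λ u → Agree u (s (inj₂ right))) mirror-below (agree-sym _ _ at-right)))
                 (marked-off-middle left left≢middle) (marked-off-middle right right≢middle)
    where
    at-right : Agree (s (inj₂ right)) (s (inj₂ (opposite below)))
    at-right = subst₂ Agree (cong (λ e → s (inj₂ e)) opposite-left)
                            (cong (λ e → s (inj₂ e)) (sym (opposite-inject₁ (inject₁ v))))
                            (agree (opposite (inject₁ v)))

  record Opening (p : Position) : Set where
    field
      ab-marked    : p ab ≡ just true
      bc-blank     : p bc ≡ nothing
      ca-blank     : p ca ≡ nothing
      middle-blank : p (inj₂ middle) ≡ nothing
      symmetric    : Symmetric p
      spare        : Σ (Fin n) λ u → u ≢ middle × p (inj₂ u) ≡ nothing

  record Mirroring (p : Position) : Set where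
    field
      blocked       : Blocked p
      middle-marked : p (inj₂ middle) ≢ nothing
      symmetric     : Symmetric p

  record Endgame (p : Position) : Set where
    field
      blocked       : Blocked p
      middle-blank  : p (inj₂ middle) ≡ nothing
      paired        : Fin n
      orientation   : Bool
      paired-marked : p (inj₂ paired) ≡ just orientation
      partner-blank : p (inj₂ (opposite paired)) ≡ nothing
      symmetricOff  : SymmetricOff paired p
      rest-marked   : ∀ u → u ≢ middle → u ≢ opposite paired → p (inj₂ u) ≢ nothing

  record Finished (p : Position) : Set where
    field
      blocked    : Blocked p
      all-marked : ∀ u → p (inj₂ u) ≢ nothing

  data OddPosition (p : Position) : Set where
    opening   : Opening p → OddPosition p
    mirroring : Mirroring p → OddPosition p
    endgame   : Endgame p → OddPosition p
    finished  : Finished p → OddPosition p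

  from-finished : Answers Finished OddPosition
  from-finished p state e o L with blocked-move (Finished.blocked state) L
  ... | i , refl = ⊥-elim (Finished.all-marked state i (proj₁ L))

  from-mirroring : Answers Mirroring OddPosition
  from-mirroring p state e o L with blocked-move (Mirroring.blocked state) L
  ... | i , refl = noCycleCell (blocked-triangle blocked)
                               (blank-cycle (opposite i) (proj₁ (proj₁ mirror)))
                 , reply (inj₂ (opposite i)) o (proj₁ mirror) (inj₂ (mirroring record
                     { blocked       = blocked
                     ; middle-marked = λ eq → middle-marked (trans (sym middle-unchanged) eq)
                     ; symmetric     = proj₂ mirror
                     }))
    where
    open Mirroring state
    i≢middle : i ≢ middle
    i≢middle refl = middle-marked (proj₁ L)
    mirror = mirror-reply {p} {i} {o} symmetric L λ fix → i≢middle (fixed-unique fix)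
    middle-unchanged : mirrored p i o (inj₂ middle) ≡ p (inj₂ middle)
    middle-unchanged = trans (play-cycle-other (λ eq → opposite-≢middle i≢middle (sym eq)))
                             (play-cycle-other (λ eq → i≢middle (sym eq)))

  module _ {p} (state : Endgame p) where
    open Endgame state
    private
      i = paired
      j = opposite paired

    paired≢middle : i ≢ middle
    paired≢middle i≡middle = just⇒≢nothing paired-marked (trans (cong (λ e → p (inj₂ e)) i≡middle) middle-blank)

    partner≢middle : j ≢ middle
    partner≢middle = opposite-≢middle paired≢middle

    endgame-middle : ∀ {o} → Legal p (inj₂ middle) o →
                     ¬ HasCycleCell (play p (inj₂ middle) o) × Reply OddPosition (play p (inj₂ middle) o)
    endgame-middle {o} L = noCycleCell (blocked-triangle blocked) (blank-cycle j sj)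
                         , reply (inj₂ j) orientation (proj₁ (complete-mirror {s} {i} off si sj (legal⇒consistent L)))
                                 (inj₂ (finished record { blocked = blocked ; all-marked = all-marked }))
      where
      s = play p (inj₂ middle) o
      off : SymmetricOff i s
      off = symmetricOff-play-fixed {p} fixed symmetricOff
      si : s (inj₂ i) ≡ just orientation
      si = trans (play-cycle-other paired≢middle) paired-marked
      sj : s (inj₂ j) ≡ nothing
      sj = trans (play-cycle-other partner≢middle) partner-blank
      all-marked : ∀ u → play s (inj₂ j) orientation (inj₂ u) ≢ nothing
      all-marked u = by-cases (u ≟F j) (u ≟F middle)
        where
        by-cases : Dec (u ≡ j) → Dec (u ≡ middle) → play s (inj₂ j) orientation (inj₂ u) ≢ nothing
        by-cases (yes refl) _          = just⇒≢nothing (play-same s (inj₂ j) orientation)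
        by-cases (no u≢j)   (yes refl) = just⇒≢nothing (trans (play-cycle-other u≢j) (play-same p (inj₂ middle) o))
        by-cases (no u≢j)   (no u≢m)   = λ eq →
          rest-marked u u≢m u≢j (trans (sym (trans (play-cycle-other u≢j) (play-cycle-other u≢m))) eq)

    marked-after-partner : ∀ {o} u → u ≢ middle → play p (inj₂ j) o (inj₂ u) ≢ nothing
    marked-after-partner {o} u u≢m = by-cases (u ≟F j)
      where
      by-cases : Dec (u ≡ j) → play p (inj₂ j) o (inj₂ u) ≢ nothing
      by-cases (yes refl) = just⇒≢nothing (play-same p (inj₂ j) o)
      by-cases (no u≢j)   = λ eq → rest-marked u u≢m u≢j (trans (sym (play-cycle-other u≢j)) eq)

    flanks-equal-after-partner : ∀ {o} → Legal p (inj₂ j) o →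
                                 play p (inj₂ j) o (inj₂ left) ≡ play p (inj₂ j) o (inj₂ right)
    flanks-equal-after-partner {o} L = by-cases (left ≟F i) (left ≟F j)
      where
      s = play p (inj₂ j) o
      off : SymmetricOff i s
      off = symmetricOff-play-pair {p} (inj₂ refl) symmetricOff
      by-flanks : s (inj₂ (opposite below)) ≡ s (inj₂ below) → s (inj₂ left) ≡ s (inj₂ right)
      by-flanks mirror-below =
        flanks-equal {s} (Consistent.along-cycle (legal⇒consistent L)) mirror-below marked-after-partner
      by-cases : Dec (left ≡ i) → Dec (left ≡ j) → s (inj₂ left) ≡ s (inj₂ right)
      by-cases (no l≢i)  (no l≢j)  = sym (trans (cong (λ e → s (inj₂ e)) (sym opposite-left)) (off left l≢i l≢j))
      by-cases (yes l≡i) _         = by-flanks (off below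
        (λ eq → below≢left (trans eq (sym l≡i)))
        (λ eq → below≢right (trans eq (trans (cong opposite (sym l≡i)) opposite-left))))
      by-cases (no _)    (yes l≡j) = by-flanks (off below
        (λ eq → below≢right (trans eq (trans (opposite-swap (sym l≡j)) opposite-left)))
        (λ eq → below≢left (trans eq (sym l≡j))))

    endgame-partner : ∀ {o} → Legal p (inj₂ j) o →
                      ¬ HasCycleCell (play p (inj₂ j) o) × Reply OddPosition (play p (inj₂ j) o)
    endgame-partner {o} L =
      noCycleCell (blocked-triangle blocked) (blank-cycle middle s-middle)
      , reply (inj₂ middle) x (fill-between middle≡ (legal⇒consistent L) s-middle (flanks-equal-after-partner L))
              (inj₂ (finished record { blocked = blocked ; all-marked = all-marked }))
      where
      s = play p (inj₂ j) o
      x = fromMaybe true (s (inj₂ left))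
      s-middle : s (inj₂ middle) ≡ nothing
      s-middle = trans (play-cycle-other (λ eq → partner≢middle (sym eq))) middle-blank
      all-marked : ∀ u → play s (inj₂ middle) x (inj₂ u) ≢ nothing
      all-marked u = by-cases (u ≟F middle)
        where
        by-cases : Dec (u ≡ middle) → play s (inj₂ middle) x (inj₂ u) ≢ nothing
        by-cases (yes refl) = just⇒≢nothing (play-same s (inj₂ middle) x)
        by-cases (no u≢m)   = λ eq → marked-after-partner u u≢m (trans (sym (play-cycle-other u≢m)) eq)

  from-endgame : Answers Endgame OddPosition
  from-endgame p state e o L with blocked-move (Endgame.blocked state) L
  ... | u , refl with u ≟F middle | u ≟F opposite (Endgame.paired state)
  ...   | yes refl | _        = endgame-middle state L
  ...   | no _     | yes refl = endgame-partner state L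
  ...   | no u≢m   | no u≢j   = ⊥-elim (Endgame.rest-marked state u u≢m u≢j (proj₁ L))

  Spare : Fin n → Position → Fin n → Set
  Spare i q u = u ≢ middle × u ≢ opposite i × q (inj₂ u) ≡ nothing

  spare? : ∀ i q → Dec (∃ (Spare i q))
  spare? i q = any? λ u → ¬? (u ≟F middle) ×-dec ¬? (u ≟F opposite i)
                    ×-dec ≡-decMaybe _≟B_ (q (inj₂ u)) nothing

  module _ {p} (state : Opening p) where
    open Opening state

    opening-fill-middle : Legal p ca false → Reply OddPosition (play p ca false)
    opening-fill-middle L = reply (inj₂ middle) x (fill-between middle≡ (legal⇒consistent L) middle-blank neighbours)
      (inj₂ (mirroring record
        { blocked       = ab-marked , refl
        ; middle-marked = just⇒≢nothing (play-same q (inj₂ middle) x)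
        ; symmetric     = symmetric-play-fixed {q} fixed symmetric
        }))
      where
      q = play p ca false
      x = fromMaybe true (q (inj₂ left))
      neighbours : q (inj₂ left) ≡ q (inj₂ right)
      neighbours = sym (trans (cong (λ e → p (inj₂ e)) (sym opposite-left)) (symmetric left))

    opening-block : ∀ {o} → Legal p (inj₂ middle) o → Reply OddPosition (play p (inj₂ middle) o)
    opening-block {o} L = reply ca false
      (block-triangle ab-marked bc-blank ca-blank (Consistent.along-cycle (legal⇒consistent L))
                      (symmetric⇒ends-agree {q} symmetric′))
      (inj₂ (mirroring record
        { blocked       = ab-marked , refl
        ; middle-marked = just⇒≢nothing (play-same p (inj₂ middle) o)
        ; symmetric     = symmetric′
        }))
      where
      q = play p (inj₂ middle) o
      symmetric′ : Symmetric q
      symmetric′ = symmetric-play-fixed {p} fixed symmetric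

    module _ {i o} (L : Legal p (inj₂ i) o) (i≢middle : i ≢ middle) where
      private
        q = play p (inj₂ i) o
        j≢i : opposite i ≢ i
        j≢i fix = i≢middle (fixed-unique fix)
        middle≢i : middle ≢ i
        middle≢i eq = i≢middle (sym eq)

      opening-mirror : ∃ (Spare i q) → Reply OddPosition q
      opening-mirror (u , u≢middle , u≢j , qu) = reply (inj₂ (opposite i)) o (proj₁ mirror)
        (inj₂ (opening record
          { ab-marked    = ab-marked
          ; bc-blank     = bc-blank
          ; ca-blank     = ca-blank
          ; middle-blank = trans (play-cycle-other (λ eq → opposite-≢middle i≢middle (sym eq)))
                                 (trans (play-cycle-other middle≢i) middle-blank)
          ; symmetric    = proj₂ mirror
          ; spare        = u , u≢middle , trans (play-cycle-other u≢j) qu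
          }))
        where
        mirror = mirror-reply {p} {i} {o} symmetric L j≢i

      opening-endgame : ¬ ∃ (Spare i q) → Reply OddPosition q
      opening-endgame none = reply ca false
        (block-triangle ab-marked bc-blank ca-blank (Consistent.along-cycle (legal⇒consistent L))
                        (symmetricOff⇒ends-agree {q} off qj))
        (inj₂ (endgame record
          { blocked       = ab-marked , refl
          ; middle-blank  = trans (play-cycle-other middle≢i) middle-blank
          ; paired        = i
          ; orientation   = o
          ; paired-marked = play-same p (inj₂ i) o
          ; partner-blank = qj
          ; symmetricOff  = off
          ; rest-marked   = λ u u≢middle u≢j qu → none (u , u≢middle , u≢j , qu)
          }))
        where
        off = symmetricOff-after {p} i o symmetric
        qj = partner-blank-after {p} symmetric L j≢i

  from-opening : Answers Opening OddPosition
  from-opening p state = respond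
    where
    open Opening state
    respond : ∀ e o → Legal p e o → ¬ HasCycleCell (play p e o) × Reply OddPosition (play p e o)
    respond (inj₁ f0) o (blank , _) with () ← trans (sym ab-marked) blank
    respond (inj₁ (fs f0)) o L with agree-just ab-marked (play-same p bc o) (Consistent.at-b (legal⇒consistent L))
    ... | refl = noCycleCell (blank-triangle (fs (fs f0)) ca-blank) (blank-cycle middle middle-blank)
               , triangle-reply (fs (fs f0)) ca-blank (Consistent.along-cycle (legal⇒consistent L)) ab-marked refl refl
    respond (inj₁ (fs (fs f0))) true L =
      noCycleCell (blank-triangle (fs f0) bc-blank) (blank-cycle middle middle-blank)
      , triangle-reply (fs f0) bc-blank (Consistent.along-cycle (legal⇒consistent L)) ab-marked refl refl
    respond (inj₁ (fs (fs f0))) false L =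
      noCycleCell (blank-triangle (fs f0) bc-blank) (blank-cycle middle middle-blank) , opening-fill-middle state L
    respond (inj₂ i) o L with i ≟F middle
    ... | yes refl = noCycleCell (blank-triangle (fs f0) bc-blank)
                       (blank-cycle (proj₁ spare)
                          (trans (play-cycle-other (proj₁ (proj₂ spare))) (proj₂ (proj₂ spare))))
                   , opening-block state L
    ... | no i≢middle = noCycleCell (blank-triangle (fs f0) bc-blank)
                          (blank-cycle middle (trans (play-cycle-other (λ eq → i≢middle (sym eq))) middle-blank))
                      , by-spare (spare? i (play p (inj₂ i) o))
      where
      by-spare : Dec (∃ (Spare i (play p (inj₂ i) o))) → Reply OddPosition (play p (inj₂ i) o)
      by-spare (yes some) = opening-mirror state L i≢middle some
      by-spare (no none)  = opening-endgame state L i≢middle none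

  odd-strategy : Strategy OddPosition
  odd-strategy p (opening state)   = from-opening p state
  odd-strategy p (mirroring state) = from-mirroring p state
  odd-strategy p (endgame state)   = from-endgame p state
  odd-strategy p (finished state)  = from-finished p state

  first-move : Reply OddPosition empty
  first-move = reply ab true
    (consistent⇒legal refl record
      { at-b = tt ; at-c = tt ; along-cycle = λ _ → tt
      ; ¬sink-a   = ab-out⇒¬sink-a refl
      ; ¬source-a = blank⇒¬source ca refl (inj₂ refl) })
    (inj₂ (opening record
      { ab-marked = refl ; bc-blank = refl ; ca-blank = refl ; middle-blank = refl
      ; symmetric = λ _ → refl ; spare = first , (λ ()) , refl }))

  player1Wins : Player1Wins (C3Cn n)
  player1Wins = reply⇒wins odd-strategy first-move

theorem5p1 : (n : ℕ) → 4 ≤ n → Player1Wins (C3Cn n)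
theorem5p1 (suc (suc (suc (suc k)))) (s≤s (s≤s (s≤s (s≤s z≤n)))) with any? (λ i → opposite i ≟F i)
... | no no-fixed                = EvenStrategy.player1Wins (suc (suc k)) λ i fixed → no-fixed (i , fixed)
... | yes (f0 , ())
... | yes (fs f0 , ())
... | yes (fs (fs v) , fixed)    = OddStrategy.player1Wins (suc (suc k)) v fixed
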